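{- Let $k\ge3$, let $b$ be a natural number and let $\alpha<\beta<\varepsilon_0$. Assume that for every ordinal context $\lambda[[\cdot]]$, ordinal $\gamma$ and natural number $r$ with $\alpha=\lambda[[\omega^\gamma\cdot r]]$, putting $\delta:=\lambda^*[[\omega^{\gamma+1}]]$, we have $r<A_{\delta_{k-1,k,A_\delta(k,b-1)}}(k,A_\delta(k,b-1))$. Then either $\alpha+1=\beta$ or $\alpha+1\le\beta\bigl[A_{\beta_{k-1,k,A_\beta(k,b-1)}}(k,A_\beta(k,b-1))\bigr]$. Moreover $A_{\alpha+1}(k,b)\le A_\beta(k,b)$.
   Context: Standard fundamental sequences for ordinals $<\varepsilon_0$: $0[x]:=0$, $(\alpha+1)[x]:=\alpha$; if $\alpha=\omega^{\alpha_1}+\dots+\omega^{\alpha_n}$ in Cantor normal form ($\alpha_1\ge\dots\ge\alpha_n$) with $\alpha_n$ a limit then $\alpha[x]:=\omega^{\alpha_1}+\dots+\omega^{\alpha_{n-1}}+\omega^{\alpha_n[x]}$, and if $\alpha_n=\beta+1$ then $\alpha[x]:=\omega^{\alpha_1}+\dots+\omega^{\alpha_{n-1}}+\omega^{\beta}\cdot x$. Extended Ackermann functions, for $\alpha<\varepsilon_0$ and $k,b<\omega$: $A_0(k,b):=b+1$; $A_{\alpha+1}(k,0):=A_\alpha(k,\cdot)^k(0)$; $A_{\alpha+1}(k,b+1):=A_\alpha(k,\cdot)^k(A_{\alpha+1}(k,b))$; for limit $\lambda$: $A_\lambda(k,0):=A_{\lambda_{k,k,0}}(k,\cdot)^k(0)$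 and $A_\lambda(k,b+1):=A_{\lambda_{k,k,A_\lambda(k,b)}}(k,\cdot)^k(A_\lambda(k,b))$, where for an ordinal $\delta$ and natural $c$: $\delta_{0,k,c}:=\delta[c]$ and $\delta_{l+1,k,c}:=\delta[A_{\delta_{l,k,c}}(k,c)]$; upper index $k$ means $k$-fold iteration. By convention $A_\alpha(k,-1):=0$. An ordinal context $\lambda[[\cdot]]$ is a Cantor-normal-form expression for an ordinal below $\varepsilon_0$ with exactly one occurrence of a placeholder $[[\cdot]]$, of one of the forms: $[[\cdot]]$; $\omega^{\alpha_1}+\dots+\omega^{\alpha_i}+[[\cdot]]+\omega^{\alpha_{i+1}}+\dots+\omega^{\alpha_n}$; or $\omega^{\alpha_1}+\dots+\omega^{\alpha_{i-1}}+\omega^{\mu[[\cdot]]}+\omega^{\alpha_{i+1}}+\dots+\omega^{\alpha_n}$ with $\mu[[\cdot]]$ again a context. $\lambda[[\xi]]$ denotes substitution of $\xi$ for the placeholder. The truncation $\lambda^*$ cuts off hereditarily all terms after the placeholder: $[[\cdot]]^*:=[[\cdot]]$; for the second form $\lambda^*[[\cdot]]:=\omega^{\alpha_1}+\dots+\omega^{\alpha_i}+[[\cdot]]$; for the third form $\lambda^*[[\cdot]]:=\omega^{\alpha_1}+\dots+\omega^{\alpha_{i-1}}+\omega^{\mu^*[[\cdot]]}$. -}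

module Defs where

open import Data.Nat using (ℕ; zero; suc; _<_; _≤_; _∸_)
open import Data.Maybe using (Maybe; just; nothing)
open import Data.Product using (_×_; ∃)
open import Data.Sum using (_⊎_)
open import Relation.Binary.PropositionalEquality using (_≡_)
open import Relation.Nullary using (¬_)

-- Ordinal notations below ε₀: Cantor-normal-form terms
--   𝟎  and  ω^ a + r  (the term ω^a + r, r the remaining summands)

data Cnf : Set where
  𝟎    : Cnf
  ω^_+_ : Cnf → Cnf → Cnf

infixr 6 ω^_+_

-- strict order on terms (lexicographic; the ordinal order on normal forms)
data _<ₒ_ : Cnf → Cnf → Set where
  z<ω  : ∀ {a r} → 𝟎 <ₒ (ω^ a + r)
  exp< : ∀ {a r a′ r′} → a <ₒ a′ → (ω^ a + r) <ₒ (ω^ a′ + r′)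
  tail< : ∀ {a r r′} → r <ₒ r′ → (ω^ a + r) <ₒ (ω^ a + r′)

_≤ₒ_ : Cnf → Cnf → Set
a ≤ₒ b = a <ₒ b ⊎ a ≡ b

data Lead≤ : Cnf → Cnf → Set where
  l𝟎 : ∀ {a} → Lead≤ 𝟎 a
  lω : ∀ {a′ r′ a} → a′ ≤ₒ a → Lead≤ (ω^ a′ + r′) a

data NF : Cnf → Set where
  nf𝟎 : NF 𝟎
  nfω : ∀ {a r} → NF a → NF r → Lead≤ r a → NF (ω^ a + r)

_⊕_ : Cnf → Cnf → Cnf
𝟎 ⊕ s = s
(ω^ a + r) ⊕ s = ω^ a + (r ⊕ s)

infixr 5 _⊕_

suc′ : Cnf → Cnf
suc′ 𝟎 = ω^ 𝟎 + 𝟎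
suc′ (ω^ a + r) = ω^ a + suc′ r

ωmul : Cnf → ℕ → Cnf
ωmul γ zero = 𝟎
ωmul γ (suc r) = ω^ γ + ωmul γ r

predOf : Cnf → Maybe Cnf
predOf 𝟎 = nothing
predOf (ω^ 𝟎 + 𝟎) = just 𝟎
predOf (ω^ (ω^ _ + _) + 𝟎) = nothing
predOf (ω^ a + r@(ω^ _ + _)) with predOf r
... | just p = just (ω^ a + p)
... | nothing = nothing

IsLimit : Cnf → Set
IsLimit α = ¬ (α ≡ 𝟎) × predOf α ≡ nothing

_[_] : Cnf → ℕ → Cnf
lastFS : Cnf → Maybe Cnf → ℕ → Cnf

𝟎 [ x ] = 𝟎
(ω^ a + 𝟎) [ x ] = lastFS a (predOf a) x
(ω^ a + r@(ω^ _ + _)) [ x ] = ω^ a + (r [ x ])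

lastFS 𝟎 _ x = 𝟎
lastFS a@(ω^ _ + _) (just b) x = ωmul b x  -- exponent b+1 : ω^b · x
lastFS a@(ω^ _ + _) nothing x = ω^ (a [ x ]) + 𝟎

-- Extended Ackermann functions, given by their inductive graph.
--   AG α k b n      :  A_α(k,b) = n
--   ItG α k j x n   :  A_α(k,·)^j(x) = n
--   SubG δ k l c ε  :  δ_{l,k,c} = ε

data AG : Cnf → ℕ → ℕ → ℕ → Set
data ItG : Cnf → ℕ → ℕ → ℕ → ℕ → Set
data SubG : Cnf → ℕ → ℕ → ℕ → Cnf → Set

data AG where
  a-zero  : ∀ {k b} → AG 𝟎 k b (suc b)
  a-suc0  : ∀ {α a k n} → predOf α ≡ just a → ItG a k k 0 n → AG α k 0 n
  a-sucS  : ∀ {α a k b m n} → predOf α ≡ just a →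
            AG α k b m → ItG a k k m n → AG α k (suc b) n
  a-lim0  : ∀ {λ′ ε k n} → IsLimit λ′ →
            SubG λ′ k k 0 ε → ItG ε k k 0 n → AG λ′ k 0 n
  a-limS  : ∀ {λ′ ε k b m n} → IsLimit λ′ → AG λ′ k b m →
            SubG λ′ k k m ε → ItG ε k k m n → AG λ′ k (suc b) n

data ItG where
  it-0 : ∀ {α k x} → ItG α k 0 x x
  it-S : ∀ {α k j x m n} → ItG α k j x m → AG α k m n → ItG α k (suc j) x n

data SubG where
  sub-0 : ∀ {δ k c} → SubG δ k 0 c (δ [ c ])
  sub-S : ∀ {δ k l c ε m} → SubG δ k l c ε → AG ε k c m →
          SubG δ k (suc l) c (δ [ m ])

-- A_δ(k,b-1), with the convention A_δ(k,-1) = 0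
APrev : Cnf → ℕ → ℕ → ℕ → Set
APrev δ k zero m = m ≡ 0
APrev δ k (suc b) m = AG δ k b m

Bound : Cnf → ℕ → ℕ → ℕ → Set
Bound δ k b n = ∃ λ m → ∃ λ ε → APrev δ k b m × SubG δ k (k ∸ 1) m ε × AG ε k m n

data Ctx : Set where
  ∙    : Ctx
  plus : Cnf → Cnf → Ctx
  pow  : Cnf → Ctx → Cnf → Ctx

plug : Ctx → Cnf → Cnf
plug ∙ ξ = ξ
plug (plus p s) ξ = p ⊕ ξ ⊕ s
plug (pow p μ s) ξ = p ⊕ (ω^ (plug μ ξ) + 𝟎) ⊕ s

trunc : Ctx → Ctx
trunc ∙ = ∙
trunc (plus p s) = plus p 𝟎
trunc (pow p μ s) = pow p (trunc μ) 𝟎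

{-# OPTIONS --safe #-}
-- Let N be the bound attached to β. If β is a successor, α < β gives α + 1 = β or
-- α + 1 ≤ β[N], the predecessor of β. If β is a limit, walk down the common prefix
-- of α and β: at a limit exponent recurse into the exponents, and at a last term
-- ω^(a+1) of β the corresponding part of α is ω^a·r + (smaller), where r < N by
-- hypothesis, so α + 1 ≤ ω^a·N = β[N].
-- For the growth claim, A_β(k,b) is the k-fold iterate of A_{β[N]}(k,·) at
-- A_β(k,b-1) ≥ b, hence A_{β[N]}(k,b) ≤ A_β(k,b); since α + 1 ≤ β[N] < β,
-- well-founded induction on β finishes the proof.
module Submission where

open import Defs
open import Data.Nat using (ℕ; zero; suc; _<_; _≤_; _≥_; _∸_; z≤n; s≤s; _≤′_; ≤′-refl; ≤′-step)
open import Data.Nat.Properties using (≤-refl; ≤-reflexive; ≤-trans; <⇒≤; ≤-<-trans; ≤⇒≤′)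
open import Data.Maybe using (just; nothing) renaming (map to mapMaybe)
open import Data.Product using (_×_; ∃; _,_; proj₁; proj₂)
open import Data.Sum using (_⊎_; inj₁; inj₂; map₂)
open import Data.Empty using (⊥-elim)
open import Relation.Nullary using (¬_)
open import Relation.Binary.PropositionalEquality using (_≡_; _≢_; refl; sym; trans; cong; subst)
open import Induction.WellFounded using (Acc; acc)

variable
  a a′ c r s t α α′ β β′ γ δ : Cnf
  k b j l m n x y z N : ℕ

<ₒ-trans : α <ₒ β → β <ₒ γ → α <ₒ γ
<ₒ-trans z<ω (exp< _) = z<ω
<ₒ-trans z<ω (tail< _) = z<ω
<ₒ-trans (exp< p) (exp< q) = exp< (<ₒ-trans p q)
<ₒ-trans (exp< p) (tail< _) = exp< p
<ₒ-trans (tail< _) (exp< q) = exp< q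
<ₒ-trans (tail< p) (tail< q) = tail< (<ₒ-trans p q)

<-≤ₒ-trans : α <ₒ β → β ≤ₒ γ → α <ₒ γ
<-≤ₒ-trans p (inj₁ q) = <ₒ-trans p q
<-≤ₒ-trans p (inj₂ refl) = p

<ₒ⇒≢𝟎 : α <ₒ β → β ≢ 𝟎
<ₒ⇒≢𝟎 z<ω ()
<ₒ⇒≢𝟎 (exp< _) ()
<ₒ⇒≢𝟎 (tail< _) ()

𝟎≤ₒ : ∀ α → 𝟎 ≤ₒ α
𝟎≤ₒ 𝟎 = inj₂ refl
𝟎≤ₒ (ω^ _ + _) = inj₁ z<ω

ω^+-monoʳ-≤ₒ : r ≤ₒ s → (ω^ a + r) ≤ₒ (ω^ a + s)
ω^+-monoʳ-≤ₒ (inj₁ r<s) = inj₁ (tail< r<s)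
ω^+-monoʳ-≤ₒ (inj₂ refl) = inj₂ refl

<ₒ-suc′ : ∀ α → α <ₒ suc′ α
<ₒ-suc′ 𝟎 = z<ω
<ₒ-suc′ (ω^ a + r) = tail< (<ₒ-suc′ r)

<ₒ⇒suc′≤ₒ : α <ₒ β → suc′ α ≤ₒ β
<ₒ⇒suc′≤ₒ {β = ω^ 𝟎 + 𝟎} z<ω = inj₂ refl
<ₒ⇒suc′≤ₒ {β = ω^ 𝟎 + (ω^ _ + _)} z<ω = inj₁ (tail< z<ω)
<ₒ⇒suc′≤ₒ {β = ω^ (ω^ _ + _) + _} z<ω = inj₁ (exp< z<ω)
<ₒ⇒suc′≤ₒ (exp< p) = inj₁ (exp< p)
<ₒ⇒suc′≤ₒ (tail< p) = ω^+-monoʳ-≤ₒ (<ₒ⇒suc′≤ₒ p)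

<ₒ-suc′⇒≤ₒ : α <ₒ suc′ β → α ≤ₒ β
<ₒ-suc′⇒≤ₒ {β = 𝟎} z<ω = inj₂ refl
<ₒ-suc′⇒≤ₒ {β = ω^ _ + _} z<ω = inj₁ z<ω
<ₒ-suc′⇒≤ₒ {β = ω^ _ + _} (exp< p) = inj₁ (exp< p)
<ₒ-suc′⇒≤ₒ {β = ω^ _ + _} (tail< p) = ω^+-monoʳ-≤ₒ (<ₒ-suc′⇒≤ₒ p)

⊕-identityʳ : ∀ α → α ⊕ 𝟎 ≡ α
⊕-identityʳ 𝟎 = refl
⊕-identityʳ (ω^ a + r) = cong (ω^ a +_) (⊕-identityʳ r)

Lead≤-<ₒ : Lead≤ r a → s <ₒ r → Lead≤ s a
Lead≤-<ₒ _ z<ω = l𝟎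
Lead≤-<ₒ (lω p) (exp< q) = lω (inj₁ (<-≤ₒ-trans q p))
Lead≤-<ₒ (lω p) (tail< _) = lω p

NF-suc′ : NF α → NF (suc′ α)
NF-suc′ nf𝟎 = nfω nf𝟎 nf𝟎 l𝟎
NF-suc′ (nfω na nf𝟎 _) = nfω na (nfω nf𝟎 nf𝟎 l𝟎) (lω (𝟎≤ₒ _))
NF-suc′ (nfω na nr@(nfω _ _ _) (lω p)) = nfω na (NF-suc′ nr) (lω p)

NF-ωmul : NF a → ∀ n → NF (ωmul a n) × Lead≤ (ωmul a n) a
NF-ωmul na zero = nf𝟎 , l𝟎
NF-ωmul na (suc n) = let (nm , l) = NF-ωmul na n in nfω na nm l , lω (inj₂ refl)

-- The case tree of predOf splits on the exponent first, so its last clause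
-- holds only propositionally.
predOf-ω^+ω^+ : ∀ a u v →
                predOf (ω^ a + (ω^ u + v)) ≡ mapMaybe (ω^ a +_) (predOf (ω^ u + v))
predOf-ω^+ω^+ 𝟎 u v with predOf (ω^ u + v)
... | just _ = refl
... | nothing = refl
predOf-ω^+ω^+ (ω^ _ + _) u v with predOf (ω^ u + v)
... | just _ = refl
... | nothing = refl

predOf-just⇒suc′ : predOf β ≡ just β′ → suc′ β′ ≡ β
predOf-just⇒suc′ {𝟎} ()
predOf-just⇒suc′ {ω^ 𝟎 + 𝟎} refl = refl
predOf-just⇒suc′ {ω^ (ω^ _ + _) + 𝟎} ()
predOf-just⇒suc′ {ω^ a + (ω^ u + v)} e rewrite predOf-ω^+ω^+ a u v
  with predOf (ω^ u + v) in eq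
predOf-just⇒suc′ {ω^ a + (ω^ u + v)} refl | just _ =
  cong (ω^ a +_) (predOf-just⇒suc′ {ω^ u + v} eq)

predOf-just⇒[] : ∀ x → predOf β ≡ just β′ → β [ x ] ≡ β′
predOf-just⇒[] {𝟎} _ ()
predOf-just⇒[] {ω^ 𝟎 + 𝟎} _ refl = refl
predOf-just⇒[] {ω^ (ω^ _ + _) + 𝟎} _ ()
predOf-just⇒[] {ω^ a + (ω^ u + v)} x e rewrite predOf-ω^+ω^+ a u v
  with predOf (ω^ u + v) in eq
predOf-just⇒[] {ω^ a + (ω^ u + v)} x refl | just _ =
  cong (ω^ a +_) (predOf-just⇒[] {ω^ u + v} x eq)

predOf-nothing-tail : ∀ a u v →
                      predOf (ω^ a + (ω^ u + v)) ≡ nothing → predOf (ω^ u + v) ≡ nothing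
predOf-nothing-tail a u v e rewrite predOf-ω^+ω^+ a u v with predOf (ω^ u + v)
... | nothing = refl

_≺_ : Cnf → Cnf → Set
γ ≺ α = NF γ × γ <ₒ α

[]-≺ : NF α → α ≢ 𝟎 → ∀ x → (α [ x ]) ≺ α
[]-≺ nf𝟎 α≢𝟎 _ = ⊥-elim (α≢𝟎 refl)
[]-≺ {ω^ 𝟎 + 𝟎} _ _ _ = nf𝟎 , z<ω
[]-≺ {ω^ (ω^ u + v) + 𝟎} (nfω na _ _) _ x with predOf (ω^ u + v) in eq
... | just a′ = proj₁ (NF-ωmul (proj₁ a′≺a) x) , ωmul<ₒ x
  where
  a′≺a : a′ ≺ (ω^ u + v)
  a′≺a = subst (_≺ (ω^ u + v)) (predOf-just⇒[] {ω^ u + v} 0 eq) ([]-≺ na (λ ()) 0)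
  ωmul<ₒ : ∀ n → ωmul a′ n <ₒ (ω^ (ω^ u + v) + 𝟎)
  ωmul<ₒ zero = z<ω
  ωmul<ₒ (suc n) = exp< (proj₂ a′≺a)
... | nothing = let (na[x] , a[x]<a) = []-≺ na (λ ()) x in nfω na[x] nf𝟎 l𝟎 , exp< a[x]<a
[]-≺ {ω^ a + (ω^ u + v)} (nfω na nr l) _ x =
  let (nr[x] , r[x]<r) = []-≺ nr (λ ()) x in nfω na nr[x] (Lead≤-<ₒ l r[x]<r) , tail< r[x]<r

predOf-just⇒≺ : NF β → predOf β ≡ just β′ → β′ ≺ β
predOf-just⇒≺ {𝟎} _ ()
predOf-just⇒≺ {β@(ω^ _ + _)} nβ e = subst (_≺ β) (predOf-just⇒[] {β} 0 e) ([]-≺ nβ (λ ()) 0)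

acc-𝟎 : Acc _≺_ 𝟎
acc-𝟎 = acc λ { (_ , ()) }

-- Lexicographic induction: on the leading exponent a, and for fixed a on the tail.
acc-ω^+ : (∀ {c} → c ≺ a → ∀ {δ} → NF δ → Lead≤ δ c → Acc _≺_ δ) →
          Acc _≺_ δ → NF δ → Lead≤ δ a → Acc _≺_ (ω^ a + δ)
acc-ω^+ {a = a} {δ = δ} below (acc rδ) nδ l = acc go
  where
  go : γ ≺ (ω^ a + δ) → Acc _≺_ γ
  go (nf𝟎 , z<ω) = acc-𝟎
  go (nγ@(nfω nc _ _) , exp< c<a) = below (nc , c<a) nγ (lω (inj₂ refl))
  go (nfω _ nε l′ , tail< ε<δ) = acc-ω^+ below (rδ (nε , ε<δ)) nε l′

acc-Lead≤ : Acc _≺_ a → NF δ → Lead≤ δ a → Acc _≺_ δ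
acc-Lead≤ _ nf𝟎 _ = acc-𝟎
acc-Lead≤ (acc rs) nδ@(nfω na′ _ _) (lω (inj₁ a′<a)) =
  acc-Lead≤ (rs (na′ , a′<a)) nδ (lω (inj₂ refl))
acc-Lead≤ aa@(acc rs) (nfω _ nδ l) (lω (inj₂ refl)) =
  acc-ω^+ (λ c≺a → acc-Lead≤ (rs c≺a)) (acc-Lead≤ aa nδ l) nδ l

≺-acc : NF α → Acc _≺_ α
≺-acc nf𝟎 = acc-𝟎
≺-acc nα@(nfω na _ _) = acc-Lead≤ (≺-acc na) nα (lω (inj₂ refl))

ItG-total : (∀ x → ∃ (AG α k x)) → ∀ j x → ∃ (ItG α k j x)
ItG-total A zero x = x , it-0
ItG-total A (suc j) x = let (m , it) = ItG-total A j x ; (n , d) = A m in n , it-S it d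

SubG-total : ∀ k → NF β → β ≢ 𝟎 → (∀ {γ} → γ ≺ β → ∀ x → ∃ (AG γ k x)) →
             ∀ l c → ∃ λ ε → SubG β k l c ε × ε ≺ β
SubG-total k nβ β≢𝟎 A zero c = _ , sub-0 , []-≺ nβ β≢𝟎 c
SubG-total k nβ β≢𝟎 A (suc l) c =
  let (_ , s , ε≺β) = SubG-total k nβ β≢𝟎 A l c ; (m , d) = A ε≺β c
  in _ , sub-S s d , []-≺ nβ β≢𝟎 m

AG-total-acc : ∀ k → NF α → Acc _≺_ α → ∀ b → ∃ (AG α k b)
AG-total-acc {𝟎} k _ _ b = suc b , a-zero
AG-total-acc {α@(ω^ _ + _)} k nα (acc rs) b with predOf α in eq
... | just α′ = successor b
  where
  A : ∀ x → ∃ (AG α′ k x)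
  A = let α′≺α = predOf-just⇒≺ nα eq in AG-total-acc k (proj₁ α′≺α) (rs α′≺α)
  successor : ∀ b → ∃ (AG α k b)
  successor zero = let (n , it) = ItG-total A k 0 in n , a-suc0 eq it
  successor (suc b) = let (m , d) = successor b ; (n , it) = ItG-total A k m
                      in n , a-sucS eq d it
... | nothing = limit b
  where
  below : γ ≺ α → ∀ x → ∃ (AG γ k x)
  below γ≺α = AG-total-acc k (proj₁ γ≺α) (rs γ≺α)
  iterate : ∀ m → ∃ λ ε → SubG α k k m ε × ∃ (ItG ε k k m)
  iterate m = let (ε , s , ε≺α) = SubG-total k nα (λ ()) below k m
              in ε , s , ItG-total (below ε≺α) k m
  limit : ∀ b → ∃ (AG α k b)
  limit zero = let (_ , s , n , it) = iterate 0 in n , a-lim0 ((λ ()) , eq) s it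
  limit (suc b) = let (m , d) = limit b ; (_ , s , n , it) = iterate m
                  in n , a-limS ((λ ()) , eq) d s it

AG-total : ∀ k → NF α → ∀ b → ∃ (AG α k b)
AG-total k nα = AG-total-acc k nα (≺-acc nα)

successor-not-limit : predOf α ≡ just α′ → ¬ IsLimit α
successor-not-limit e (_ , e′) with trans (sym e) e′
... | ()

AG-functional : AG α k b m → AG α k b n → m ≡ n
ItG-functional : ItG α k j x m → ItG α k j x n → m ≡ n
SubG-functional : SubG δ k l x α → SubG δ k l x β → α ≡ β

AG-functional a-zero a-zero = refl
AG-functional a-zero (a-suc0 () _)
AG-functional a-zero (a-sucS () _ _)
AG-functional a-zero (a-lim0 l _ _) = ⊥-elim (proj₁ l refl)
AG-functional a-zero (a-limS l _ _ _) = ⊥-elim (proj₁ l refl)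
AG-functional (a-suc0 () _) a-zero
AG-functional (a-suc0 e it) (a-suc0 e′ it′) with trans (sym e) e′
... | refl = ItG-functional it it′
AG-functional (a-suc0 e _) (a-lim0 l _ _) = ⊥-elim (successor-not-limit e l)
AG-functional (a-sucS () _ _) a-zero
AG-functional (a-sucS e d it) (a-sucS e′ d′ it′) with trans (sym e) e′ | AG-functional d d′
... | refl | refl = ItG-functional it it′
AG-functional (a-sucS e _ _) (a-limS l _ _ _) = ⊥-elim (successor-not-limit e l)
AG-functional (a-lim0 l _ _) a-zero = ⊥-elim (proj₁ l refl)
AG-functional (a-lim0 l _ _) (a-suc0 e _) = ⊥-elim (successor-not-limit e l)
AG-functional (a-lim0 _ s it) (a-lim0 _ s′ it′) with SubG-functional s s′
... | refl = ItG-functional it it′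
AG-functional (a-limS l _ _ _) a-zero = ⊥-elim (proj₁ l refl)
AG-functional (a-limS l _ _ _) (a-sucS e _ _) = ⊥-elim (successor-not-limit e l)
AG-functional (a-limS _ d s it) (a-limS _ d′ s′ it′) with AG-functional d d′
... | refl with SubG-functional s s′
... | refl = ItG-functional it it′

ItG-functional it-0 it-0 = refl
ItG-functional (it-S it d) (it-S it′ d′) with ItG-functional it it′
... | refl = AG-functional d d′

SubG-functional sub-0 sub-0 = refl
SubG-functional (sub-S s d) (sub-S s′ d′) with SubG-functional s s′
... | refl with AG-functional d d′
... | refl = refl

AG-inflationary : AG α (suc k) b n → b < n
ItG-inflationary : ItG α (suc k) j x n → x ≤ n
ItG-suc-inflationary : ItG α (suc k) (suc j) x n → x < n

AG-inflationary a-zero = ≤-refl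
AG-inflationary (a-suc0 _ it) = ItG-suc-inflationary it
AG-inflationary (a-sucS _ d it) = ≤-<-trans (AG-inflationary d) (ItG-suc-inflationary it)
AG-inflationary (a-lim0 _ _ it) = ItG-suc-inflationary it
AG-inflationary (a-limS _ d _ it) = ≤-<-trans (AG-inflationary d) (ItG-suc-inflationary it)

ItG-inflationary it-0 = ≤-refl
ItG-inflationary (it-S it d) = ≤-trans (ItG-inflationary it) (<⇒≤ (AG-inflationary d))

ItG-suc-inflationary (it-S it d) = ≤-<-trans (ItG-inflationary it) (AG-inflationary d)

AG-defined-pred : AG α k (suc b) n → ∃ (AG α k b)
AG-defined-pred a-zero = _ , a-zero
AG-defined-pred (a-sucS _ d _) = _ , d
AG-defined-pred (a-limS _ d _ _) = _ , d

AG-<-suc : AG α (suc k) b m → AG α (suc k) (suc b) n → m < n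
AG-<-suc d a-zero with AG-functional d a-zero
... | refl = ≤-refl
AG-<-suc d (a-sucS _ d′ it) with AG-functional d d′
... | refl = ItG-suc-inflationary it
AG-<-suc d (a-limS _ d′ _ it) with AG-functional d d′
... | refl = ItG-suc-inflationary it

AG-mono : AG α (suc k) x m → AG α (suc k) y n → x ≤ y → m ≤ n
AG-mono dx dy x≤y = go dx dy (≤⇒≤′ x≤y)
  where
  go : AG α (suc k) x m → AG α (suc k) y n → x ≤′ y → m ≤ n
  go dx dy ≤′-refl = ≤-reflexive (AG-functional dx dy)
  go dx dy (≤′-step x≤′y) =
    let (_ , dy′) = AG-defined-pred dy in ≤-trans (go dx dy′ x≤′y) (<⇒≤ (AG-<-suc dy′ dy))

AG≤ItG : ItG γ (suc k) (suc j) m y → AG γ (suc k) x z → x ≤ m → z ≤ y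
AG≤ItG (it-S it d) dz x≤m = AG-mono dz d (≤-trans x≤m (ItG-inflationary it))

-- A_β(k,b) = A_{β[N]}(k,·)^k(A_β(k,b-1)) in every case: a successor's fundamental
-- sequence is constantly its predecessor, and for a limit β_{k,k,m} = β[N] by the
-- definition of Bound.
AG-[]≤ : Bound β (suc k) b N → AG (β [ N ]) (suc k) b z → AG β (suc k) b y → z ≤ y
AG-[]≤ _ dz a-zero = ≤-reflexive (AG-functional dz a-zero)
AG-[]≤ {β} {N = N} _ dz (a-suc0 e it) =
  AG≤ItG it (subst (λ γ → AG γ _ _ _) (predOf-just⇒[] {β} N e) dz) z≤n
AG-[]≤ {β} {N = N} _ dz (a-sucS e d it) =
  AG≤ItG it (subst (λ γ → AG γ _ _ _) (predOf-just⇒[] {β} N e) dz) (AG-inflationary d)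
AG-[]≤ (_ , _ , refl , s , dN) dz (a-lim0 _ (sub-S s′ d′) it) with SubG-functional s′ s
... | refl with AG-functional d′ dN
... | refl = AG≤ItG it dz z≤n
AG-[]≤ (_ , _ , dm , s , dN) dz (a-limS _ d (sub-S s′ d′) it) with AG-functional d dm
... | refl with SubG-functional s′ s
... | refl with AG-functional d′ dN
... | refl = AG≤ItG it dz (AG-inflationary d)

CoefficientsBelow : ℕ → Cnf → Cnf → Set
CoefficientsBelow N α β = ∀ λ′ γ r → NF γ → α ≡ plug λ′ (ωmul γ r) →
                          plug (trunc λ′) (ω^ suc′ γ + 𝟎) ≡ β → r < N

CoefficientsBelow-tail : CoefficientsBelow N (ω^ a + α) (ω^ a + β) → CoefficientsBelow N α β
CoefficientsBelow-tail {a = a} H ∙ γ r nγ refl refl =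
  H (plus (ω^ a + 𝟎) 𝟎) γ r nγ (cong (ω^ a +_) (sym (⊕-identityʳ _)))
                                (cong (ω^ a +_) (⊕-identityʳ _))
CoefficientsBelow-tail {a = a} H (plus p s) γ r nγ refl refl =
  H (plus (ω^ a + p) s) γ r nγ refl refl
CoefficientsBelow-tail {a = a} H (pow p μ s) γ r nγ refl refl =
  H (pow (ω^ a + p) μ s) γ r nγ refl refl

CoefficientsBelow-exponent : CoefficientsBelow N (ω^ c + α) (ω^ a + 𝟎) → CoefficientsBelow N c a
CoefficientsBelow-exponent {α = α} H λ′ γ r nγ refl refl = H (pow 𝟎 λ′ α) γ r nγ refl refl

leading-block : NF (ω^ a + t) →
                ∃ λ r → ∃ λ rest → (ω^ a + t) ≡ ωmul a (suc r) ⊕ rest × rest <ₒ (ω^ a + 𝟎)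
leading-block {t = 𝟎} _ = 0 , 𝟎 , refl , z<ω
leading-block {t = ω^ _ + _} (nfω _ _ (lω (inj₁ e<a))) = 0 , _ , refl , exp< e<a
leading-block {a} {t = ω^ _ + _} (nfω _ nt (lω (inj₂ refl))) =
  let (r , rest , e , rest<) = leading-block nt in suc r , rest , cong (ω^ a +_) e , rest<

suc′-block≤ₒ : ∀ {r} → t <ₒ (ω^ a + 𝟎) → r < N → suc′ (ωmul a r ⊕ t) ≤ₒ ωmul a N
suc′-block≤ₒ {r = zero} z<ω (s≤s _) = <ₒ⇒suc′≤ₒ z<ω
suc′-block≤ₒ {r = zero} (exp< e<a) (s≤s _) = <ₒ⇒suc′≤ₒ (exp< e<a)
suc′-block≤ₒ {r = suc _} t< (s≤s r<N) = ω^+-monoʳ-≤ₒ (suc′-block≤ₒ t< r<N)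

suc′≤ₒωmul : suc′ a′ ≡ a → NF α → α <ₒ (ω^ a + 𝟎) → CoefficientsBelow N α (ω^ a + 𝟎) → 0 < N →
             suc′ α ≤ₒ ωmul a′ N
suc′≤ₒωmul _ _ z<ω _ N>0 = suc′-block≤ₒ z<ω N>0
suc′≤ₒωmul {a′} {N = N} e nα@(nfω nc _ _) (exp< c<a) H N>0
  with <ₒ-suc′⇒≤ₒ (subst (_ <ₒ_) (sym e) c<a)
... | inj₁ c<a′ = suc′-block≤ₒ (exp< c<a′) N>0
... | inj₂ refl =
  let (r , rest , α≡ , rest<) = leading-block nα
  in subst (λ ξ → suc′ ξ ≤ₒ ωmul a′ N) (sym α≡)
       (suc′-block≤ₒ rest< (H (plus 𝟎 rest) a′ (suc r) nc α≡ (cong (λ ξ → ω^ ξ + 𝟎) e)))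

suc′≤ₒ[]-limit : ∀ β → NF β → predOf β ≡ nothing → NF α → α <ₒ β →
                 CoefficientsBelow N α β → 0 < N → suc′ α ≤ₒ (β [ N ])
suc′≤ₒ[]-limit (ω^ a + (ω^ u + v)) _ _ _ z<ω _ _ = <ₒ⇒suc′≤ₒ z<ω
suc′≤ₒ[]-limit (ω^ a + (ω^ u + v)) _ _ _ (exp< c<a) _ _ = inj₁ (exp< c<a)
suc′≤ₒ[]-limit (ω^ a + (ω^ u + v)) (nfω _ nr _) lim (nfω _ nα′ _) (tail< α′<r) H N>0 =
  ω^+-monoʳ-≤ₒ (suc′≤ₒ[]-limit (ω^ u + v) nr (predOf-nothing-tail a u v lim) nα′ α′<r
                                (CoefficientsBelow-tail H) N>0)
suc′≤ₒ[]-limit (ω^ (ω^ u + v) + 𝟎) (nfω na _ _) _ nα α<β H N>0 with predOf (ω^ u + v) in eq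
... | just _ = suc′≤ₒωmul (predOf-just⇒suc′ {ω^ u + v} eq) nα α<β H N>0
... | nothing with α<β | nα
...   | z<ω | _ = <ₒ⇒suc′≤ₒ z<ω
...   | exp< c<a | nfω nc _ _ =
  let suc′c≤a[N] = suc′≤ₒ[]-limit (ω^ u + v) na eq nc c<a (CoefficientsBelow-exponent H) N>0
  in inj₁ (exp< (<-≤ₒ-trans (<ₒ-suc′ _) suc′c≤a[N]))

CoefficientsBounded : ℕ → ℕ → Cnf → Set
CoefficientsBounded k b α = (λ′ : Ctx) (γ : Cnf) (r : ℕ) → NF γ → α ≡ plug λ′ (ωmul γ r) →
                            ∀ n → Bound (plug (trunc λ′) (ω^ suc′ γ + 𝟎)) k b n → r < n

CoefficientsBounded⇒Below : CoefficientsBounded k b α → Bound β k b N → CoefficientsBelow N α β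
CoefficientsBounded⇒Below H bound λ′ γ r nγ α≡ refl = H λ′ γ r nγ α≡ _ bound

Bound-total : ∀ k b → NF β → β ≢ 𝟎 → ∃ (Bound β k b)
Bound-total {β} k b nβ β≢𝟎 =
  let (m , dm) = previous b
      (ε , s , nε , _) = SubG-total k nβ β≢𝟎 (λ γ≺β → AG-total k (proj₁ γ≺β)) (k ∸ 1) m
      (N , dN) = AG-total k nε m
  in N , m , ε , dm , s , dN
  where
  previous : ∀ b → ∃ (APrev β k b)
  previous zero = 0 , refl
  previous (suc b) = AG-total k nβ b

suc′≤ₒ-fundamental : NF α → NF β → α <ₒ β → CoefficientsBounded (suc k) b α →
                     Bound β (suc k) b N → (suc′ α ≡ β) ⊎ (suc′ α ≤ₒ (β [ N ]))
suc′≤ₒ-fundamental {α} {β} {N = N} nα nβ α<β H bound with predOf β in eq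
... | just β′ with <ₒ-suc′⇒≤ₒ (subst (α <ₒ_) (sym (predOf-just⇒suc′ {β} eq)) α<β)
...   | inj₂ refl = inj₁ (predOf-just⇒suc′ {β} eq)
...   | inj₁ α<β′ =
  inj₂ (subst (suc′ α ≤ₒ_) (sym (predOf-just⇒[] {β} N eq)) (<ₒ⇒suc′≤ₒ α<β′))
suc′≤ₒ-fundamental nα nβ α<β H bound@(_ , _ , _ , _ , dN) | nothing =
  inj₂ (suc′≤ₒ[]-limit _ nβ eq nα α<β (CoefficientsBounded⇒Below H bound)
                       (≤-<-trans z≤n (AG-inflationary dN)))

AG-suc′≤ : NF α → NF β → Acc _≺_ β → α <ₒ β → CoefficientsBounded (suc k) b α →
           AG (suc′ α) (suc k) b x → AG β (suc k) b y → x ≤ y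
AG-suc′≤ {α} {β} {k} {b} nα nβ (acc rs) α<β H dx dy
  with Bound-total (suc k) b nβ (<ₒ⇒≢𝟎 α<β)
... | N , bound with suc′≤ₒ-fundamental nα nβ α<β H bound
...   | inj₁ refl = ≤-reflexive (AG-functional dx dy)
...   | inj₂ suc′α≤β[N] with []-≺ nβ (<ₒ⇒≢𝟎 α<β) N
...     | β[N]≺β with AG-total (suc k) (proj₁ β[N]≺β) b
...       | z , dz = ≤-trans (suc′α≤β[N]⇒≤z suc′α≤β[N]) (AG-[]≤ bound dz dy)
  where
  suc′α≤β[N]⇒≤z : suc′ α ≤ₒ (β [ N ]) → _ ≤ z
  suc′α≤β[N]⇒≤z (inj₂ suc′α≡β[N]) =
    ≤-reflexive (AG-functional dx (subst (λ γ → AG γ (suc k) b z) (sym suc′α≡β[N]) dz))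
  suc′α≤β[N]⇒≤z (inj₁ suc′α<β[N]) =
    AG-suc′≤ nα (proj₁ β[N]≺β) (rs β[N]≺β) (<ₒ-trans (<ₒ-suc′ α) suc′α<β[N]) H dx dz

mainTheorem8 : (k b : ℕ) → k ≥ 3 → (α β : Cnf) → NF α → NF β → α <ₒ β →
  ((λ′ : Ctx) (γ : Cnf) (r : ℕ) → NF γ → α ≡ plug λ′ (ωmul γ r) →
    ∀ n → Bound (plug (trunc λ′) (ω^ suc′ γ + 𝟎)) k b n → r < n) →
  ((suc′ α ≡ β) ⊎ (∃ λ n → Bound β k b n × suc′ α ≤ₒ (β [ n ])))
  × (∃ λ x → ∃ λ y → AG (suc′ α) k b x × AG β k b y × x ≤ y)
mainTheorem8 zero _ ()
mainTheorem8 (suc k) b _ α β nα nβ α<β H =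
  let (N , bound) = Bound-total (suc k) b nβ (<ₒ⇒≢𝟎 α<β)
      (x , dx) = AG-total (suc k) (NF-suc′ nα) b
      (y , dy) = AG-total (suc k) nβ b
  in map₂ (λ le → N , bound , le) (suc′≤ₒ-fundamental nα nβ α<β H bound)
   , (x , y , dx , dy , AG-suc′≤ nα nβ (≺-acc nβ) α<β H dx dy)
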